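{- Let $\mathcal{T}_{\mathrm{Sch}}$ be the generating tree of the succession rule (NewSch): the root is labelled $(1,1)$, and a vertex labelled $(h,k)$ has children labelled $$(1,k+1),\ldots,(h,k+1),\ (2,1),\ldots,(2,k-1),\ (h+1,k).$$ Let $\mathcal{T}_{\mathrm{Bax}}$ be the generating tree of the succession rule (Bax): the root is labelled $(1,1)$, and a vertex labelled $(h,k)$ has children labelled $$(1,k+1),\ldots,(h,k+1),\ (h+1,1),\ldots,(h+1,k).$$ Then $\mathcal{T}_{\mathrm{Sch}}$ is isomorphic to a subtree of $\mathcal{T}_{\mathrm{Bax}}$. That is, there is an injective map from the vertices of $\mathcal{T}_{\mathrm{Sch}}$ to the vertices of $\mathcal{T}_{\mathrm{Bax}}$ that sends the root to the root and sends children of any vertex to children of its image.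
   Context: A succession rule consists of a root label and, for each label, a list of the labels of its children. It determines an infinite rooted labelled tree: the root is at depth $1$ and every vertex with label $\lambda$ has one child for each label in the production of $\lambda$. -}

module Defs where

open import Data.Nat using (ℕ; suc; _∸_)
open import Data.Product using (Σ; _×_; _,_)
open import Data.List using (List; _∷_; []; _++_; map; upTo; length; lookup)
open import Data.Fin using (Fin)

record Rule : Set₁ where
  field
    Label : Set
    rootLabel : Label
    prod : Label → List Label
open Rule public

data Node (r : Rule) : Label r → Set where
  root  : Node r (rootLabel r)
  child : ∀ {ℓ} → Node r ℓ → (i : Fin (length (prod r ℓ))) → Node r (lookup (prod r ℓ) i)

Vertex : Rule → Set
Vertex r = Σ (Label r) (Node r)

rootV : (r : Rule) → Vertex r
rootV r = rootLabel r , root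

childV : (r : Rule) (v : Vertex r) → Fin (length (prod r (Σ.proj₁ v))) → Vertex r
childV r (ℓ , n) i = lookup (prod r ℓ) i , child n i

schProd : ℕ × ℕ → List (ℕ × ℕ)
schProd (h , k) =
  map (λ i → (suc i , suc k)) (upTo h)
  ++ map (λ j → (2 , suc j)) (upTo (k ∸ 1))
  ++ ((suc h , k) ∷ [])

baxProd : ℕ × ℕ → List (ℕ × ℕ)
baxProd (h , k) =
  map (λ i → (suc i , suc k)) (upTo h)
  ++ map (λ j → (suc h , suc j)) (upTo k)

Sch : Rule
Sch = record { Label = ℕ × ℕ ; rootLabel = (1 , 1) ; prod = schProd }

Bax : Rule
Bax = record { Label = ℕ × ℕ ; rootLabel = (1 , 1) ; prod = baxProd }

-- Label a Sch vertex (h , k) and a Bax vertex (h' , k) by the same k and let h ≤ h'.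
-- Then the children of the Sch vertex embed, in order, among those of the Bax vertex,
-- each child again related to its partner: (i , k+1) ↦ (i , k+1), (2 , j) ↦ (h'+1 , j)
-- and (h+1 , k) ↦ (h'+1 , k). An order-preserving, hence injective, matching of children
-- that propagates down the trees is exactly an embedding of the generating trees.
module Submission where

open import Defs
open import Data.Fin using (Fin; zero; suc; toℕ)
open import Data.Fin.Properties using (suc-injective; toℕ-injective)
open import Data.List using ([]; _∷_; _++_; [_]; map; applyUpTo; length; lookup)
open import Data.List.Relation.Binary.Sublist.Heterogeneous using (Sublist; []; _∷_; _∷ʳ_)
open import Data.Maybe using (Maybe; just; nothing)
open import Data.Maybe.Properties using (just-injective)
open import Data.Nat using (ℕ; suc; _≤_; z≤n; s≤s)
open import Data.Nat.Properties using (≤-refl)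
open import Data.Product using (Σ; ∃; _×_; _,_; proj₁; proj₂)
open import Function.Definitions using (Injective)
open import Relation.Binary.Core using (REL)
open import Relation.Binary.PropositionalEquality using (_≡_; refl; cong)

private
  variable
    A B : Set
    R : REL A B _

Sublist-index : ∀ {xs ys} → Sublist R xs ys → Fin (length xs) → Fin (length ys)
Sublist-index (y ∷ʳ p) i       = suc (Sublist-index p i)
Sublist-index (r ∷ p)  zero    = zero
Sublist-index (r ∷ p)  (suc i) = suc (Sublist-index p i)

Sublist-index-injective : ∀ {xs ys} (p : Sublist R xs ys) → Injective _≡_ _≡_ (Sublist-index p)
Sublist-index-injective (y ∷ʳ p) eq = Sublist-index-injective p (suc-injective eq)
Sublist-index-injective (r ∷ p) {zero}  {zero}  eq = refl
Sublist-index-injective (r ∷ p) {suc i} {suc j} eq =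
  cong suc (Sublist-index-injective p (suc-injective eq))

Sublist-lookup-index : ∀ {xs ys} (p : Sublist R xs ys) (i : Fin (length xs)) →
                       R (lookup xs i) (lookup ys (Sublist-index p i))
Sublist-lookup-index (y ∷ʳ p) i       = Sublist-lookup-index p i
Sublist-lookup-index (r ∷ p)  zero    = r
Sublist-lookup-index (r ∷ p)  (suc i) = Sublist-lookup-index p i

map-applyUpTo-++-⊆ : (f : ℕ → A) (g : ℕ → ℕ) → (∀ i → R (f i) (f i)) →
                     ∀ {m n xs ys} → m ≤ n → Sublist R xs ys →
                     Sublist R (map f (applyUpTo g m) ++ xs) (map f (applyUpTo g n) ++ ys)
map-applyUpTo-++-⊆ f g R-refl {n = 0}     z≤n     p = p
map-applyUpTo-++-⊆ f g R-refl {n = suc n} z≤n     p =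
  f (g 0) ∷ʳ map-applyUpTo-++-⊆ f (λ i → g (suc i)) R-refl z≤n p
map-applyUpTo-++-⊆ f g R-refl (s≤s m≤n) p =
  R-refl (g 0) ∷ map-applyUpTo-++-⊆ f (λ i → g (suc i)) R-refl m≤n p

map-applyUpTo-∷ʳ-⊆ : (f : ℕ → A) (f′ : ℕ → B) (g : ℕ → ℕ) → (∀ i → R (f i) (f′ i)) →
                     ∀ n {x} → R x (f′ (g n)) →
                     Sublist R (map f (applyUpTo g n) ++ [ x ]) (map f′ (applyUpTo g (suc n)))
map-applyUpTo-∷ʳ-⊆ f f′ g R-pointwise 0       r = r ∷ []
map-applyUpTo-∷ʳ-⊆ f f′ g R-pointwise (suc n) r =
  R-pointwise (g 0) ∷ map-applyUpTo-∷ʳ-⊆ f f′ (λ i → g (suc i)) R-pointwise n r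

-- Inverts childV: distinguishes root from children and recovers a child's parent and
-- position, avoiding unification on the (non-variable) label indices of Node.
unchild : (r : Rule) → Vertex r → Maybe (Vertex r × ℕ)
unchild r (_ , root)      = nothing
unchild r (_ , child n i) = just ((_ , n) , toℕ i)

module SublistSimulation
  (r s : Rule) (_≼_ : Label r → Label s → Set)
  (rootLabel-≼ : rootLabel r ≼ rootLabel s)
  (prod-⊆ : ∀ {a b} → a ≼ b → Sublist _≼_ (prod r a) (prod s b))
  where

  embedNode : ∀ {a} → Node r a → Σ (Vertex s) λ w → a ≼ proj₁ w
  embedNode root = rootV s , rootLabel-≼
  embedNode (child n i) with embedNode n
  ... | w , a≼b = childV s w (Sublist-index (prod-⊆ a≼b) i)
                , Sublist-lookup-index (prod-⊆ a≼b) i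

  embed : Vertex r → Vertex s
  embed (_ , n) = proj₁ (embedNode n)

  embedNode-injective : ∀ {a a′} (n : Node r a) (m : Node r a′) →
                        proj₁ (embedNode n) ≡ proj₁ (embedNode m) → (a , n) ≡ (a′ , m)
  embedNode-injective root        root        eq = refl
  embedNode-injective root        (child m j) eq with cong (unchild s) eq
  ... | ()
  embedNode-injective (child n i) root        eq with cong (unchild s) eq
  ... | ()
  embedNode-injective (child n i) (child m j) eq
    with just-injective (cong (unchild s) eq)
  ... | parents-and-positions
    with embedNode-injective n m (cong proj₁ parents-and-positions)
  ...   | refl = cong (childV r (_ , n))
                      (Sublist-index-injective (prod-⊆ (proj₂ (embedNode n)))
                        (toℕ-injective (cong proj₂ parents-and-positions)))

  embed-injective : Injective _≡_ _≡_ embed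
  embed-injective {_ , n} {_ , m} = embedNode-injective n m

  embedding : Σ (Vertex r → Vertex s) λ f →
                Injective _≡_ _≡_ f
                × f (rootV r) ≡ rootV s
                × ((v : Vertex r) (i : Fin (length (prod r (proj₁ v)))) →
                     ∃ λ (j : Fin (length (prod s (proj₁ (f v))))) →
                       f (childV r v i) ≡ childV s (f v) j)
  embedding = embed , embed-injective , refl , λ { (_ , n) i → _ , refl }

data _≼_ : ℕ × ℕ → ℕ × ℕ → Set where
  ≼-intro : ∀ {h h′ k} → h ≤ suc h′ → (h , suc k) ≼ (suc h′ , suc k)

schProd-⊆-baxProd : ∀ {a b} → a ≼ b → Sublist _≼_ (schProd a) (baxProd b)
schProd-⊆-baxProd {h , suc k} {suc h′ , suc k} (≼-intro h≤h′) =
  map-applyUpTo-++-⊆ _ (λ i → i) (λ _ → ≼-intro ≤-refl) h≤h′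
    (map-applyUpTo-∷ʳ-⊆ _ _ (λ i → i) (λ _ → ≼-intro (s≤s (s≤s z≤n))) k (≼-intro (s≤s h≤h′)))

theorem4 : Σ (Vertex Sch → Vertex Bax) λ f →
             Injective _≡_ _≡_ f
             × f (rootV Sch) ≡ rootV Bax
             × ((v : Vertex Sch) (i : Fin (length (prod Sch (proj₁ v)))) →
                  ∃ λ (j : Fin (length (prod Bax (proj₁ (f v))))) →
                    f (childV Sch v i) ≡ childV Bax (f v) j)
theorem4 = SublistSimulation.embedding Sch Bax _≼_ (≼-intro ≤-refl) schProd-⊆-baxProd
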